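{- Let $G$ be a graph. If there are integers $a\geq 0$ and $b\geq 2$ such that $\phi^a_b(G)\geq 2\chi(G)$, then $\chi_c(G)=\chi(G)$.
   Context: All graphs are finite and simple; $N(v)$ is the open neighborhood of $v$. The circular complete graph $K_{n/d}$ ($n\geq 2d$) has vertex set $\{0,\ldots,n-1\}$ with $i\sim j$ iff $d\leq|i-j|\leq n-d$; $\chi_c(G)$ is the minimum $n/d$ with $\gcd(n,d)=1$ such that $G$ has a homomorphism to $K_{n/d}$. An independent set $F$ is a free independent set if it is contained in at least two distinct maximal independent sets. An edge $e=uv$ supports $F$ if $F\cap(N(u)\cup N(v))=\emptyset$. For integers $a\geq 0$, $b\geq 1$, $\phi^a_b(G)$ is the minimum natural number $t$ such that: (1) $V(G)$ can be partitioned into independent sets $V_1,\ldots,V_t$ with $V_1,\ldots,V_{t-a}$ free independent sets; and (2) there are edges $e_1,\ldots,e_{t-a}$ (not necessarily distinct) with $e_i$ supporting $V_i$, such that every vertex is incident with $e_i$ for at most $b$ indices $i$. If no such $t$ exists, $\phi^a_b(G)=\infty$. -}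

module Defs where

open import Data.Nat using (ℕ; _+_; _*_; _∸_; _≤_; ∣_-_∣)
open import Data.Nat.Properties using (m∸n≤m)
open import Data.Nat.Coprimality using (Coprime)
open import Data.Bool using (Bool; true; false; _∨_)
open import Data.Fin using (Fin; toℕ; inject≤; _≟_)
open import Data.Fin.Subset using (Subset; _∈_; _∉_; _⊆_)
open import Data.Vec using (tabulate)
open import Data.List using (List; length; filterᵇ; allFin)
open import Data.Product using (Σ; ∃; ∃-syntax; _×_; _,_; proj₁; proj₂)
open import Relation.Nullary using (¬_; ⌊_⌋)
open import Relation.Binary.PropositionalEquality using (_≡_; _≢_)

record Graph : Set where
  field
    n         : ℕ
    adj       : Fin n → Fin n → Bool
    adj-sym   : ∀ u v → adj u v ≡ adj v u
    adj-irref : ∀ u → adj u u ≡ false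

open Graph public

Edge : (G : Graph) → Fin (n G) → Fin (n G) → Set
Edge G u v = adj G u v ≡ true

HasEdge : Graph → Set
HasEdge G = ∃[ u ] ∃[ v ] Edge G u v

ProperColouring : (G : Graph) (k : ℕ) → (Fin (n G) → Fin k) → Set
ProperColouring G k c = ∀ u v → Edge G u v → c u ≢ c v

Colourable : Graph → ℕ → Set
Colourable G k = Σ (Fin (n G) → Fin k) (ProperColouring G k)

IsChromaticNumber : Graph → ℕ → Set
IsChromaticNumber G k = Colourable G k × (∀ m → Colourable G m → k ≤ m)

CircAdj : (p d : ℕ) → Fin p → Fin p → Set
CircAdj p d i j = d ≤ ∣ toℕ i - toℕ j ∣ × ∣ toℕ i - toℕ j ∣ ≤ p ∸ d

HomToCirc : Graph → ℕ → ℕ → Set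
HomToCirc G p d =
  Σ (Fin (n G) → Fin p) λ f → ∀ u v → Edge G u v → CircAdj p d (f u) (f v)

CircAdmissible : Graph → ℕ → ℕ → Set
CircAdmissible G p d = 1 ≤ d × 2 * d ≤ p × Coprime p d × HomToCirc G p d

IsCircChromatic : Graph → ℕ → ℕ → Set
IsCircChromatic G p d =
  CircAdmissible G p d ×
  (∀ p' d' → CircAdmissible G p' d' → p * d' ≤ p' * d)

module _ (G : Graph) where

  Independent : Subset (n G) → Set
  Independent S = ∀ u v → u ∈ S → v ∈ S → ¬ Edge G u v

  MaximalIndependent : Subset (n G) → Set
  MaximalIndependent S =
    Independent S × (∀ T → Independent T → S ⊆ T → T ⊆ S)

  FreeIndependent : Subset (n G) → Set
  FreeIndependent F =
    Independent F ×
    ∃[ M₁ ] ∃[ M₂ ] (MaximalIndependent M₁ × MaximalIndependent M₂ ×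
                     F ⊆ M₁ × F ⊆ M₂ × M₁ ≢ M₂)

  Supports : Fin (n G) → Fin (n G) → Subset (n G) → Set
  Supports u v F = ∀ w → w ∈ F → ¬ Edge G u w × ¬ Edge G v w

  Class : {t : ℕ} → (Fin (n G) → Fin t) → Fin t → Subset (n G)
  Class c i = tabulate (λ v → ⌊ c v ≟ i ⌋)

  incidences : {k : ℕ} → (Fin k → Fin (n G) × Fin (n G)) → Fin (n G) → ℕ
  incidences {k} e x =
    length (filterᵇ (λ j → ⌊ proj₁ (e j) ≟ x ⌋ ∨ ⌊ proj₂ (e j) ≟ x ⌋)
                    (allFin k))

  -- Parts V_1..V_t are the classes of c; the first t-a of them (indices
  -- 0 .. t∸a-1, embedded via inject≤) must be free, supported by e_j.
  PhiFeasible : (a b t : ℕ) → Set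
  PhiFeasible a b t =
    Σ (Fin (n G) → Fin t) λ c →
      (∀ i → Independent (Class c i)) ×
      Σ (Fin (t ∸ a) → Fin (n G) × Fin (n G)) λ e →
        (∀ j → FreeIndependent (Class c (inject≤ j (m∸n≤m t a)))) ×
        (∀ j → Edge G (proj₁ (e j)) (proj₂ (e j))) ×
        (∀ j → Supports (proj₁ (e j)) (proj₂ (e j))
                        (Class c (inject≤ j (m∸n≤m t a)))) ×
        (∀ x → incidences e x ≤ b)

  -- φ^a_b(G) ≥ m  (φ = ∞ when no t is feasible, in which case this holds)
  PhiAtLeast : (a b m : ℕ) → Set
  PhiAtLeast a b m = ∀ t → PhiFeasible a b t → m ≤ t

-- Let k = χ(G). We show by strong induction on P that every homomorphism G → K_{P/D} has
-- k D ≤ P, i.e. P/D ≥ k, so χ_c(G) = k. Colourings by K_{P/1} are proper colourings. If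
-- g = gcd(P, D) > 1, dividing colours by g gives a colouring by K_{(P/g)/(D/g)}. If some colour z
-- is not tight (no vertex of colour z has a neighbour of colour z − D), recolour z by z − 1,
-- rotate so that colour 0 is unused, and apply x ↦ ⌊x Q / P⌋ for the Farey neighbour Q/D' of
-- P/D (P D' − Q D = 1); this gives a colouring by K_{Q/D'} with Q < P and Q/D' < P/D. Otherwise
-- every colour is tight: the t = ⌈P/(D−1)⌉ blocks of D − 1 consecutive colours are free
-- independent sets, each supported by a tight edge at the colour just after it, and every vertex
-- lies on at most two of these edges. So 2k ≤ φ^a_b(G) ≤ t, which forces k D ≤ P.

module Submission where

open import Defs
open import Data.Nat
open import Data.Nat.Properties
open import Data.Nat.DivMod
open import Data.Nat.Divisibility
  using (_∣_; divides; ∣m+n∣m⇒∣n; ∣⇒≤; n∣m*n; ∣m⇒∣m*n; m%n≡0⇒n∣m)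
open import Data.Nat.GCD using (module Bézout; gcd; gcd[m,n]∣m; gcd[m,n]∣n; gcd[m,n]≢0)
open import Data.Nat.Coprimality as Coprimality
  using (Coprime; coprime?; coprime-Bézout; gcd≡1⇒coprime; 1-coprimeTo)
open import Data.Nat.Induction using (<-rec)
open import Data.Nat.Tactic.RingSolver using (solve-∀)
open import Algebra.Properties.CommutativeSemigroup +-commutativeSemigroup using (xy∙z≈xz∙y)
open import Data.Bool using (Bool; true; false; _∨_; T)
open import Data.Bool.Properties as Bool using (T-≡)
open import Data.Fin using (Fin; toℕ; fromℕ<; inject≤) renaming (_≟_ to _≟ᶠ_)
open import Data.Fin.Properties using (any?; toℕ<n; toℕ-fromℕ<; toℕ-injective; inject≤-injective)
open import Data.Fin.Subset using (Subset; _∈_; _⊆_; _∪_; ⁅_⁆)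
open import Data.Fin.Subset.Properties using (_∈?_; x∈⁅x⁆; x∈⁅y⁆⇒x≡y; p⊆p∪q; q⊆p∪q; x∈p∪q⁻)
open import Data.Vec.Properties using (lookup∘tabulate; []=⇒lookup)
open import Data.List using (List; []; _∷_; length; filterᵇ; allFin)
open import Data.List.Properties using (filter-none)
import Data.List.Relation.Unary.All as All
open import Data.List.Relation.Unary.AllPairs using (_∷_)
open import Data.List.Relation.Unary.Any using (here; there)
open import Data.List.Relation.Unary.Unique.Propositional using (Unique)
open import Data.List.Relation.Unary.Unique.Propositional.Properties using (allFin⁺)
import Data.List.Membership.Propositional as List
open import Data.List.Membership.Propositional.Properties using (∈-allFin)
open import Data.Unit using (⊤; tt)
open import Data.Product using (Σ-syntax; ∃-syntax; _×_; _,_; proj₁; proj₂)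
open import Data.Sum using (_⊎_; inj₁; inj₂)
open import Function using (_∘_; Injective; Equivalence)
open import Relation.Nullary using (¬_; Dec; yes; no; ⌊_⌋; contradiction)
open import Relation.Nullary.Decidable using (_×-dec_; ¬?; T?; map′; toWitness; decidable-stable)
open import Relation.Binary using (tri<; tri≈; tri>)
open import Relation.Binary.PropositionalEquality

variable
  P D m x y : ℕ

-- Arithmetic modulo P

[m%n+o]%n≡[m+o]%n : ∀ m o n .{{_ : NonZero n}} → (m % n + o) % n ≡ (m + o) % n
[m%n+o]%n≡[m+o]%n m o n = begin
  (m % n + o) % n         ≡⟨ %-distribˡ-+ (m % n) o n ⟩
  (m % n % n + o % n) % n ≡⟨ cong (λ r → (r + o % n) % n) (m%n%n≡m%n m n) ⟩
  (m % n + o % n) % n     ≡⟨ %-distribˡ-+ m o n ⟨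
  (m + o) % n             ∎
  where open ≡-Reasoning

[m+o]%n≢m%n : ∀ m {o n} .{{_ : NonZero n}} → 0 < o → o < n → (m + o) % n ≢ m % n
[m+o]%n≢m%n m {o} {n} 0<o o<n eq = <⇒≱ o<n (∣⇒≤ {{>-nonZero 0<o}} n∣o)
  where
  quotients : m / n * n + o ≡ (m + o) / n * n
  quotients = +-cancelˡ-≡ (m % n) _ _ (begin
    m % n + (m / n * n + o)       ≡⟨ +-assoc (m % n) _ o ⟨
    m % n + m / n * n + o         ≡⟨ cong (_+ o) (m≡m%n+[m/n]*n m n) ⟨
    m + o                         ≡⟨ m≡m%n+[m/n]*n (m + o) n ⟩
    (m + o) % n + (m + o) / n * n ≡⟨ cong (_+ (m + o) / n * n) eq ⟩
    m % n + (m + o) / n * n       ∎)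
    where open ≡-Reasoning
  n∣o : n ∣ o
  n∣o = ∣m+n∣m⇒∣n (divides ((m + o) / n) quotients) (n∣m*n (m / n))

m+[n∸m%n]≡[1+m/n]*n : ∀ m n .{{_ : NonZero n}} → m + (n ∸ m % n) ≡ suc (m / n) * n
m+[n∸m%n]≡[1+m/n]*n m n = begin
  m + (n ∸ m % n)                 ≡⟨ cong (_+ (n ∸ m % n)) (m≡m%n+[m/n]*n m n) ⟩
  m % n + m / n * n + (n ∸ m % n) ≡⟨ cong (_+ (n ∸ m % n)) (+-comm (m % n) _) ⟩
  m / n * n + m % n + (n ∸ m % n) ≡⟨ +-assoc (m / n * n) (m % n) _ ⟩
  m / n * n + (m % n + (n ∸ m % n)) ≡⟨ cong (m / n * n +_) (m+[n∸m]≡n (m%n≤n m n)) ⟩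
  m / n * n + n                   ≡⟨ +-comm (m / n * n) n ⟩
  suc (m / n) * n                 ∎
  where open ≡-Reasoning

[m+o]%n≡[k+o]%n⇒m%n≡k%n : ∀ m k o {n} .{{_ : NonZero n}} →
                          (m + o) % n ≡ (k + o) % n → m % n ≡ k % n
[m+o]%n≡[k+o]%n⇒m%n≡k%n m k o {n} eq =
  trans (sym (undo m)) (trans (cong (λ r → (r + (n ∸ o % n)) % n) eq) (undo k))
  where
  undo : ∀ j → ((j + o) % n + (n ∸ o % n)) % n ≡ j % n
  undo j = begin
    ((j + o) % n + (n ∸ o % n)) % n ≡⟨ [m%n+o]%n≡[m+o]%n (j + o) (n ∸ o % n) n ⟩
    (j + o + (n ∸ o % n)) % n       ≡⟨ cong (_% n) (+-assoc j o _) ⟩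
    (j + (o + (n ∸ o % n))) % n     ≡⟨ cong (λ v → (j + v) % n) (m+[n∸m%n]≡[1+m/n]*n o n) ⟩
    (j + suc (o / n) * n) % n       ≡⟨ [m+kn]%n≡m%n j (suc (o / n)) n ⟩
    j % n                           ∎
    where open ≡-Reasoning

[m+kn]/n≡m/n+k : ∀ m k n .{{_ : NonZero n}} → (m + k * n) / n ≡ m / n + k
[m+kn]/n≡m/n+k m k n = trans (+-distrib-/-∣ʳ m (n∣m*n k)) (cong (m / n +_) (m*n/n≡m k n))

m+n+[o∸n]≡m+o : ∀ m {n o} → n ≤ o → m + n + (o ∸ n) ≡ m + o
m+n+[o∸n]≡m+o m {n} {o} n≤o = trans (+-assoc m n (o ∸ n)) (cong (m +_) (m+[n∸m]≡n n≤o))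

[m*[n%o]]%o≡[m*n]%o : ∀ m n o .{{_ : NonZero o}} → (m * (n % o)) % o ≡ (m * n) % o
[m*[n%o]]%o≡[m*n]%o m n o = begin
  (m * (n % o)) % o           ≡⟨ %-distribˡ-* m (n % o) o ⟩
  (m % o * (n % o % o)) % o   ≡⟨ cong (λ v → (m % o * v) % o) (m%n%n≡m%n n o) ⟩
  (m % o * (n % o)) % o       ≡⟨ %-distribˡ-* m n o ⟨
  (m * n) % o                 ∎
  where open ≡-Reasoning

[m+o]%n-cases : .{{_ : NonZero P}} → x < P → m ≤ P → (x + m) % P ≡ y → y ≡ x + m ⊎ x ≡ y + (P ∸ m)
[m+o]%n-cases {P} {x} {m} {y} x<P m≤P eq with x + m <? P
... | yes x+m<P = inj₁ (trans (sym eq) (m<n⇒m%n≡m x+m<P))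
... | no x+m≮P with m≤n⇒∃[o]m+o≡n (≮⇒≥ x+m≮P)
...   | w , P+w≡x+m = inj₂ (+-cancelʳ-≡ m x _ (begin
  x + m             ≡⟨ P+w≡x+m ⟨
  P + w             ≡⟨ +-comm P w ⟩
  w + P             ≡⟨ cong (w +_) (m∸n+n≡m m≤P) ⟨
  w + (P ∸ m + m)   ≡⟨ +-assoc w (P ∸ m) m ⟨
  w + (P ∸ m) + m   ≡⟨ cong (λ v → v + (P ∸ m) + m) y≡w ⟨
  y + (P ∸ m) + m   ∎))
  where
  open ≡-Reasoning
  w<P : w < P
  w<P = +-cancelˡ-< P w P (subst (_< P + P) (sym P+w≡x+m) (+-mono-<-≤ x<P m≤P))
  y≡w : y ≡ w
  y≡w = begin
    y               ≡⟨ eq ⟨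
    (x + m) % P     ≡⟨ cong (_% P) (trans (sym P+w≡x+m) (+-comm P w)) ⟩
    (w + P) % P     ≡⟨ [m+n]%n≡m%n w P ⟩
    w % P           ≡⟨ m<n⇒m%n≡m w<P ⟩
    w               ∎

m,n<o⇒∣m-n∣<o : ∀ {m n o} → m < o → n < o → ∣ m - n ∣ < o
m,n<o⇒∣m-n∣<o {m} {n} m<o n<o = ≤-<-trans (∣m-n∣≤m⊔n m n) (⊔-pres-<m m<o n<o)

m/o≡n/o⇒∣m-n∣<o : ∀ m n o .{{_ : NonZero o}} → m / o ≡ n / o → ∣ m - n ∣ < o
m/o≡n/o⇒∣m-n∣<o m n o same =
  subst (_< o) (sym ∣m-n∣≡∣m%o-n%o∣) (m,n<o⇒∣m-n∣<o (m%n<n m o) (m%n<n n o))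
  where
  ∣m-n∣≡∣m%o-n%o∣ : ∣ m - n ∣ ≡ ∣ m % o - n % o ∣
  ∣m-n∣≡∣m%o-n%o∣ = begin
    ∣ m - n ∣                                 ≡⟨ cong₂ ∣_-_∣ (trans (m≡m%n+[m/n]*n m o) (+-comm (m % o) _))
                                                              (trans (m≡m%n+[m/n]*n n o) (+-comm (n % o) _)) ⟩
    ∣ m / o * o + m % o - n / o * o + n % o ∣ ≡⟨ cong (λ k → ∣ m / o * o + m % o - k * o + n % o ∣) same ⟨
    ∣ m / o * o + m % o - m / o * o + n % o ∣ ≡⟨ ∣m+n-m+o∣≡∣n-o∣ (m / o * o) (m % o) (n % o) ⟩
    ∣ m % o - n % o ∣                         ∎
    where open ≡-Reasoning

¬coprime⇒common-factor : ∀ {P D} .{{_ : NonZero P}} → ¬ Coprime P D →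
                          ∃[ g ] ∃[ P₁ ] ∃[ D₁ ] 1 < g × P₁ < P × P ≡ P₁ * g × D ≡ D₁ * g
¬coprime⇒common-factor {P} {D} ¬coprime with gcd[m,n]∣m P D | gcd[m,n]∣n P D
... | divides P₁ P≡P₁g | divides D₁ D≡D₁g = g , P₁ , D₁ , 1<g , P₁<P , P≡P₁g , D≡D₁g
  where
  g : ℕ
  g = gcd P D
  1<g : 1 < g
  1<g = ≤∧≢⇒< (n≢0⇒n>0 (gcd[m,n]≢0 P D (inj₁ (≢-nonZero⁻¹ P))))
              (¬coprime ∘ gcd≡1⇒coprime ∘ sym)
  P₁<P : P₁ < P
  P₁<P = subst (P₁ <_) (sym P≡P₁g)
    (m<m*n P₁ g {{≢-nonZero λ P₁≡0 → ≢-nonZero⁻¹ P (trans P≡P₁g (cong (_* g) P₁≡0))}} 1<g)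

-- The circular complete graphs K_{P/D}

-- Defs.CircAdj on ℕ rather than Fin P, as a record so that its indices can be inferred.
record CircAdjℕ (P D x y : ℕ) : Set where
  constructor circAdj
  field
    D≤dist   : D ≤ ∣ x - y ∣
    dist≤P∸D : ∣ x - y ∣ ≤ P ∸ D

CircJump : ℕ → ℕ → ℕ → Set
CircJump P D m = D ≤ m × m + D ≤ P

circAdj-sym : CircAdjℕ P D x y → CircAdjℕ P D y x
circAdj-sym {P} {D} {x} {y} (circAdj lo hi) =
  circAdj (subst (D ≤_) (∣-∣-comm x y) lo) (subst (_≤ P ∸ D) (∣-∣-comm x y) hi)

circAdj-irrefl : 1 ≤ D → ¬ CircAdjℕ P D x x
circAdj-irrefl {D} {x = x} 1≤D (circAdj D≤0 _) = <⇒≱ 1≤D (subst (D ≤_) (∣n-n∣≡0 x) D≤0)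

circAdj-+⁺ : ∀ x → CircJump P D m → CircAdjℕ P D x (x + m)
circAdj-+⁺ {P} {D} {m} x (D≤m , m+D≤P) =
  circAdj (subst (D ≤_) (sym (∣m-m+n∣≡n x m)) D≤m)
          (subst (_≤ P ∸ D) (sym (∣m-m+n∣≡n x m)) (m+n≤o⇒m≤o∸n m m+D≤P))

circAdj-+⁻ : ∀ x → CircAdjℕ P D x (x + m) → CircJump P D m
circAdj-+⁻ {P} {D} {m} x (circAdj lo hi) = D≤m , m≤o∸n⇒m+n≤o m D≤P m≤P∸D
  where
  D≤m : D ≤ m
  D≤m = subst (D ≤_) (∣m-m+n∣≡n x m) lo
  m≤P∸D : m ≤ P ∸ D
  m≤P∸D = subst (_≤ P ∸ D) (∣m-m+n∣≡n x m) hi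
  D≤P : D ≤ P
  D≤P = ≤-trans D≤m (≤-trans m≤P∸D (m∸n≤m P D))

circJump⇒≤ : CircJump P D m → m ≤ P
circJump⇒≤ {m = m} (_ , m+D≤P) = m+n≤o⇒m≤o m m+D≤P

circJump-complement : CircJump P D m → CircJump P D (P ∸ m)
circJump-complement {P} {D} {m} jump@(D≤m , m+D≤P) =
  m+n≤o⇒m≤o∸n D (subst (_≤ P) (+-comm m D) m+D≤P) ,
  ≤-trans (+-monoʳ-≤ (P ∸ m) D≤m) (≤-reflexive (m∸n+n≡m (circJump⇒≤ jump)))

circAdj-between : x + D ≤ y → y + D ≤ x + P → CircAdjℕ P D x y
circAdj-between {x} {D} {y} {P} lo hi with m≤n⇒∃[o]m+o≡n (≤-trans (m≤m+n x D) lo)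
... | w , refl =
  circAdj-+⁺ x (+-cancelˡ-≤ x D w lo , +-cancelˡ-≤ x (w + D) P (subst (_≤ x + P) (+-assoc x w D) hi))

circAdj-wlog : (R : ℕ → ℕ → Set) → (∀ {x y} → R x y → R y x) →
               (∀ {x m} → CircJump P D m → R x (x + m)) →
               CircAdjℕ P D x y → R x y
circAdj-wlog {x = x} {y} R R-sym R-+ adj with ≤-total x y
... | inj₁ x≤y with m≤n⇒∃[o]m+o≡n x≤y
...   | m , refl = R-+ (circAdj-+⁻ x adj)
circAdj-wlog {x = x} {y} R R-sym R-+ adj | inj₂ y≤x with m≤n⇒∃[o]m+o≡n y≤x
...   | m , refl = R-sym (R-+ (circAdj-+⁻ y (circAdj-sym adj)))

circAdj⇒circAdjℕ : ∀ {P D} {i j : Fin P} → CircAdj P D i j → CircAdjℕ P D (toℕ i) (toℕ j)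
circAdj⇒circAdjℕ (lo , hi) = circAdj lo hi

circAdjℕ⇒circAdj : ∀ {P D} {i j : Fin P} → CircAdjℕ P D (toℕ i) (toℕ j) → CircAdj P D i j
circAdjℕ⇒circAdj (circAdj lo hi) = lo , hi

-- The upper bound for a jump m is the lower bound (spread) for the complementary jump P − m.
module _ {P D P' D' : ℕ} (Ok : ℕ → Set) (f : ℕ → ℕ)
         (f-+P : ∀ x → f (x + P) ≡ f x + P')
         (f-spread : ∀ {x m} → Ok x → D ≤ m → f x + D' ≤ f (x + m)) where

  circAdj-transfer : Ok x → Ok y → CircAdjℕ P D x y → CircAdjℕ P' D' (f x) (f y)
  circAdj-transfer okx oky adj =
    circAdj-wlog (λ x y → Ok x → Ok y → CircAdjℕ P' D' (f x) (f y))
                 (λ r oky okx → circAdj-sym (r okx oky)) jump-transfer adj okx oky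
    where
    jump-transfer : ∀ {x m} → CircJump P D m → Ok x → Ok (x + m) →
                    CircAdjℕ P' D' (f x) (f (x + m))
    jump-transfer {x} {m} jump okx okx+m = circAdj-between (f-spread okx (proj₁ jump)) (begin
      f (x + m) + D'      ≤⟨ f-spread okx+m (proj₁ (circJump-complement jump)) ⟩
      f (x + m + (P ∸ m)) ≡⟨ cong f (m+n+[o∸n]≡m+o x (circJump⇒≤ jump)) ⟩
      f (x + P)           ≡⟨ f-+P x ⟩
      f x + P'            ∎)
      where open ≤-Reasoning

circAdj⇒D+D≤P : CircAdjℕ P D x y → D + D ≤ P
circAdj⇒D+D≤P {P} {D} (circAdj lo hi) = m≤o∸n⇒m+n≤o D (≤-trans D≤P∸D (m∸n≤m P D)) D≤P∸D
  where
  D≤P∸D : D ≤ P ∸ D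
  D≤P∸D = ≤-trans lo hi

CircShift : (P D x y : ℕ) .{{_ : NonZero P}} → Set
CircShift P D x y = ∃[ m ] CircJump P D m × (x + m) % P ≡ y

module _ {P D : ℕ} .{{_ : NonZero P}} where

  circShift-sym : x < P → CircShift P D x y → CircShift P D y x
  circShift-sym {x} {y} x<P (m , jump , refl) = P ∸ m , circJump-complement jump , (begin
    ((x + m) % P + (P ∸ m)) % P ≡⟨ [m%n+o]%n≡[m+o]%n (x + m) (P ∸ m) P ⟩
    (x + m + (P ∸ m)) % P       ≡⟨ cong (_% P) (m+n+[o∸n]≡m+o x (circJump⇒≤ jump)) ⟩
    (x + P) % P                 ≡⟨ [m+n]%n≡m%n x P ⟩
    x % P                       ≡⟨ m<n⇒m%n≡m x<P ⟩
    x                           ∎)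
    where open ≡-Reasoning

  circAdj⇒circShift : x < P → y < P → CircAdjℕ P D x y → CircShift P D x y
  circAdj⇒circShift x<P y<P adj =
    circAdj-wlog (λ x y → x < P → y < P → CircShift P D x y)
                 (λ r y<P x<P → circShift-sym x<P (r x<P y<P))
                 (λ {_} {m} jump _ x+m<P → m , jump , m<n⇒m%n≡m x+m<P)
                 adj x<P y<P

  circShift⇒circAdj : x < P → CircShift P D x y → CircAdjℕ P D x y
  circShift⇒circAdj {x} {y} x<P (m , jump , eq) with [m+o]%n-cases x<P (circJump⇒≤ jump) eq
  ... | inj₁ refl = circAdj-+⁺ x jump
  ... | inj₂ refl = circAdj-sym (circAdj-+⁺ y (circJump-complement jump))

  circShift-rotate : ∀ s → CircShift P D x y → CircShift P D ((x + s) % P) ((y + s) % P)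
  circShift-rotate {x} s (m , jump , refl) = m , jump , (begin
    ((x + s) % P + m) % P ≡⟨ [m%n+o]%n≡[m+o]%n (x + s) m P ⟩
    (x + s + m) % P       ≡⟨ cong (_% P) (xy∙z≈xz∙y x s m) ⟩
    (x + m + s) % P       ≡⟨ [m%n+o]%n≡[m+o]%n (x + m) s P ⟨
    ((x + m) % P + s) % P ∎)
    where open ≡-Reasoning

  circAdj-rotate : ∀ s → x < P → y < P → CircAdjℕ P D x y →
                   CircAdjℕ P D ((x + s) % P) ((y + s) % P)
  circAdj-rotate s x<P y<P adj =
    circShift⇒circAdj (m%n<n _ P) (circShift-rotate s (circAdj⇒circShift x<P y<P adj))

  ¬circAdj-close : ∀ {s} → x < P → y < P → s < D → (y + s) % P ≡ x → ¬ CircAdjℕ P D x y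
  ¬circAdj-close {x} {y} {s} x<P y<P s<D eq adj with circAdj⇒circShift x<P y<P adj
  ... | m , (D≤m , m+D≤P) , x+m≡y = [m+o]%n≢m%n y 0<s+m s+m<P (begin
    (y + (s + m)) % P     ≡⟨ cong (_% P) (+-assoc y s m) ⟨
    (y + s + m) % P       ≡⟨ [m%n+o]%n≡[m+o]%n (y + s) m P ⟨
    ((y + s) % P + m) % P ≡⟨ cong (λ v → (v + m) % P) eq ⟩
    (x + m) % P           ≡⟨ x+m≡y ⟩
    y                     ≡⟨ m<n⇒m%n≡m y<P ⟨
    y % P                 ∎)
    where
    open ≡-Reasoning
    0<s+m : 0 < s + m
    0<s+m = <-≤-trans (≤-<-trans z≤n s<D) (≤-trans D≤m (m≤n+m m s))
    s+m<P : s + m < P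
    s+m<P = <-≤-trans (subst (s + m <_) (+-comm D m) (+-monoˡ-< m s<D)) m+D≤P

  circAdj-push : ∀ {z c} → z < P → c < P → CircAdjℕ P D z c → (c + D) % P ≢ z →
                 CircAdjℕ P D ((z + pred P) % P) c
  circAdj-push {z} {c} z<P c<P adj c+D≢z with circAdj⇒circShift z<P c<P adj
  ... | m , (D≤m , m+D≤P) , z+m≡c = circShift⇒circAdj (m%n<n _ P) (suc m , jump , z-1+[1+m]≡c)
    where
    open ≡-Reasoning
    m+D≢P : m + D ≢ P
    m+D≢P m+D≡P = c+D≢z (begin
      (c + D) % P           ≡⟨ cong (λ v → (v + D) % P) z+m≡c ⟨
      ((z + m) % P + D) % P ≡⟨ [m%n+o]%n≡[m+o]%n (z + m) D P ⟩
      (z + m + D) % P       ≡⟨ cong (_% P) (trans (+-assoc z m D) (cong (z +_) m+D≡P)) ⟩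
      (z + P) % P           ≡⟨ [m+n]%n≡m%n z P ⟩
      z % P                 ≡⟨ m<n⇒m%n≡m z<P ⟩
      z                     ∎)
    jump : CircJump P D (suc m)
    jump = m≤n⇒m≤1+n D≤m , ≤∧≢⇒< m+D≤P m+D≢P
    z-1+[1+m]≡c : ((z + pred P) % P + suc m) % P ≡ c
    z-1+[1+m]≡c = begin
      ((z + pred P) % P + suc m) % P ≡⟨ [m%n+o]%n≡[m+o]%n (z + pred P) (suc m) P ⟩
      (z + pred P + suc m) % P       ≡⟨ cong (_% P) (+-assoc z (pred P) (suc m)) ⟩
      (z + (pred P + suc m)) % P     ≡⟨ cong (λ v → (z + v) % P) (+-suc (pred P) m) ⟩
      (z + suc (pred P + m)) % P     ≡⟨ cong (λ v → (z + (v + m)) % P) (suc-pred P) ⟩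
      (z + (P + m)) % P              ≡⟨ cong (λ v → (z + v) % P) (+-comm P m) ⟩
      (z + (m + P)) % P              ≡⟨ cong (_% P) (+-assoc z m P) ⟨
      (z + m + P) % P                ≡⟨ [m+n]%n≡m%n (z + m) P ⟩
      (z + m) % P                    ≡⟨ z+m≡c ⟩
      c                              ∎

-- Farey neighbours and common factors

-- For a Farey neighbour Q/D' of P/D, x ↦ ⌊x Q / P⌋ maps K_{P/D} without vertex 0 to K_{Q/D'}.
module Farey {P D D' Q : ℕ} .{{_ : NonZero P}} (bézout : P * D' ≡ Q * D + 1) where

  farey : ℕ → ℕ
  farey x = x * Q / P

  farey-+P : ∀ x → farey (x + P) ≡ farey x + Q
  farey-+P x = begin
    (x + P) * Q / P     ≡⟨ cong (_/ P) (trans (*-distribʳ-+ Q x P) (cong (x * Q +_) (*-comm P Q))) ⟩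
    (x * Q + Q * P) / P ≡⟨ [m+kn]/n≡m/n+k (x * Q) Q P ⟩
    farey x + Q         ∎
    where open ≡-Reasoning

  P∤xQ : 0 < x → x < P → ¬ P ∣ x * Q
  P∤xQ {x} 0<x x<P P∣xQ = <⇒≱ x<P (∣⇒≤ {{>-nonZero 0<x}} P∣x)
    where
    xQD+x≡xPD' : x * Q * D + x ≡ x * P * D'
    xQD+x≡xPD' = begin
      x * Q * D + x   ≡⟨ x*y*z+x≡x*[y*z+1] x Q D ⟩
      x * (Q * D + 1) ≡⟨ cong (x *_) bézout ⟨
      x * (P * D')    ≡⟨ *-assoc x P D' ⟨
      x * P * D'      ∎
      where
      open ≡-Reasoning
      x*y*z+x≡x*[y*z+1] : ∀ x y z → x * y * z + x ≡ x * (y * z + 1)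
      x*y*z+x≡x*[y*z+1] = solve-∀
    P∣x : P ∣ x
    P∣x = ∣m+n∣m⇒∣n (subst (P ∣_) (sym xQD+x≡xPD') (∣m⇒∣m*n D' (n∣m*n x))) (∣m⇒∣m*n D P∣xQ)

  -- The remainder of x Q modulo P is at least 1, which absorbs the 1 in P D' = Q D + 1.
  farey-spread : ¬ P ∣ x * Q → D ≤ m → farey x + D' ≤ farey (x + m)
  farey-spread {x} {m} P∤xQ D≤m =
    subst (_≤ farey (x + m)) (m*n/n≡m (farey x + D') P) (/-monoˡ-≤ P bound)
    where
    r : ℕ
    r = x * Q % P
    1≤r : 1 ≤ r
    1≤r = n≢0⇒n>0 (λ r≡0 → P∤xQ (m%n≡0⇒n∣m (x * Q) P r≡0))
    bound : (farey x + D') * P ≤ (x + m) * Q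
    bound = begin
      (farey x + D') * P            ≡⟨ *-distribʳ-+ P (farey x) D' ⟩
      farey x * P + D' * P          ≡⟨ cong (farey x * P +_) (trans (*-comm D' P) bézout) ⟩
      farey x * P + (Q * D + 1)     ≤⟨ +-monoʳ-≤ (farey x * P) (+-monoʳ-≤ (Q * D) 1≤r) ⟩
      farey x * P + (Q * D + r)     ≡⟨ rearrange (farey x * P) Q D r ⟩
      r + farey x * P + D * Q       ≡⟨ cong (_+ D * Q) (m≡m%n+[m/n]*n (x * Q) P) ⟨
      x * Q + D * Q                 ≤⟨ +-monoʳ-≤ (x * Q) (*-monoˡ-≤ Q D≤m) ⟩
      x * Q + m * Q                 ≡⟨ *-distribʳ-+ Q x m ⟨
      (x + m) * Q                   ∎
      where
      open ≤-Reasoning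
      rearrange : ∀ a Q D r → a + (Q * D + r) ≡ r + a + D * Q
      rearrange = solve-∀

  farey-circAdj : ¬ P ∣ x * Q → ¬ P ∣ y * Q → CircAdjℕ P D x y → CircAdjℕ Q D' (farey x) (farey y)
  farey-circAdj {x} {y} =
    circAdj-transfer (λ x → ¬ P ∣ x * Q) farey farey-+P (λ {x} {m} → farey-spread {x} {m}) {x} {y}

  farey<Q : .{{_ : NonZero Q}} → x < P → farey x < Q
  farey<Q {x} x<P = m<n*o⇒m/o<n (subst (x * Q <_) (*-comm P Q) (*-monoˡ-< Q x<P))

circAdj-/ : ∀ {g} .{{_ : NonZero g}} → CircAdjℕ (P * g) (D * g) x y → CircAdjℕ P D (x / g) (y / g)
circAdj-/ {P} {D} {g = g} = circAdj-transfer (λ _ → ⊤) (_/ g) (λ x → [m+kn]/n≡m/n+k x P g) spread tt tt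
  where
  spread : ∀ {x m} → ⊤ → D * g ≤ m → x / g + D ≤ (x + m) / g
  spread {x} {m} _ Dg≤m = subst (_≤ (x + m) / g) ([m+kn]/n≡m/n+k x D g) (/-monoˡ-≤ g (+-monoʳ-≤ x Dg≤m))

FareyNeighbour : ℕ → ℕ → Set
FareyNeighbour P D = ∃[ D' ] ∃[ Q ] D' < D × P * D' ≡ Q * D + 1

[P*t]%D≡1⇒fareyNeighbour : ∀ t .{{_ : NonZero D}} → (P * t) % D ≡ 1 → FareyNeighbour P D
[P*t]%D≡1⇒fareyNeighbour {D} {P} t Pt%D≡1 = t % D , P * (t % D) / D , m%n<n t D , (begin
  P * (t % D)                               ≡⟨ m≡m%n+[m/n]*n (P * (t % D)) D ⟩
  P * (t % D) % D + P * (t % D) / D * D     ≡⟨ cong (_+ P * (t % D) / D * D) P*[t%D]%D≡1 ⟩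
  1 + P * (t % D) / D * D                   ≡⟨ +-comm 1 _ ⟩
  P * (t % D) / D * D + 1                   ∎)
  where
  open ≡-Reasoning
  P*[t%D]%D≡1 : P * (t % D) % D ≡ 1
  P*[t%D]%D≡1 = trans ([m*[n%o]]%o≡[m*n]%o P t D) Pt%D≡1

farey-neighbour : Coprime P D → 2 ≤ D → FareyNeighbour P D
farey-neighbour {P} {D = suc d} coprime 2≤D with coprime-Bézout coprime
... | Bézout.+- x y 1+yD≡xP = [P*t]%D≡1⇒fareyNeighbour {P = P} x (begin
  (P * x) % suc d           ≡⟨ cong (_% suc d) (trans (*-comm P x) (sym 1+yD≡xP)) ⟩
  (1 + y * suc d) % suc d   ≡⟨ [m+kn]%n≡m%n 1 y (suc d) ⟩
  1 % suc d                 ≡⟨ m<n⇒m%n≡m 2≤D ⟩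
  1                         ∎)
  where open ≡-Reasoning
... | Bézout.-+ x y 1+xP≡yD = [P*t]%D≡1⇒fareyNeighbour {P = P} (x * d) (begin
  (P * (x * d)) % suc d               ≡⟨ [m+kn]%n≡m%n (P * (x * d)) y (suc d) ⟨
  (P * (x * d) + y * suc d) % suc d   ≡⟨ cong (λ v → (P * (x * d) + v) % suc d) 1+xP≡yD ⟨
  (P * (x * d) + (1 + x * P)) % suc d ≡⟨ cong (_% suc d) (regroup P x d) ⟩
  (1 + P * x * suc d) % suc d         ≡⟨ [m+kn]%n≡m%n 1 (P * x) (suc d) ⟩
  1 % suc d                           ≡⟨ m<n⇒m%n≡m 2≤D ⟩
  1                                   ∎)
  where
  open ≡-Reasoning
  regroup : ∀ P x d → P * (x * d) + (1 + x * P) ≡ 1 + P * x * suc d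
  regroup = solve-∀

module _ {P D D' Q : ℕ} (bézout : P * D' ≡ Q * D + 1) where

  QD<PD' : Q * D < P * D'
  QD<PD' = subst (Q * D <_) (trans (+-comm 1 (Q * D)) (sym bézout)) ≤-refl

  farey-neighbour-< : D' < D → Q < P
  farey-neighbour-< D'<D = *-cancelʳ-< D Q P (<-≤-trans QD<PD' (*-monoʳ-≤ P (<⇒≤ D'<D)))

  farey-neighbour-bound : ∀ {k} → k * D' ≤ Q → k * D ≤ P
  farey-neighbour-bound {k} kD'≤Q = <⇒≤ (*-cancelʳ-< D' (k * D) P (begin-strict
    k * D * D'   ≡⟨ *-assoc k D D' ⟩
    k * (D * D') ≡⟨ cong (k *_) (*-comm D D') ⟩
    k * (D' * D) ≡⟨ *-assoc k D' D ⟨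
    k * D' * D   ≤⟨ *-monoˡ-≤ D kD'≤Q ⟩
    Q * D        <⟨ QD<PD' ⟩
    P * D'       ∎))
    where open ≤-Reasoning

-- Maximal independent sets and incidence counts

module _ {A : Set} where

  length-filterᵇ-∨ : ∀ (p q : A → Bool) xs →
                     length (filterᵇ (λ x → p x ∨ q x) xs) ≤ length (filterᵇ p xs) + length (filterᵇ q xs)
  length-filterᵇ-∨ p q [] = z≤n
  length-filterᵇ-∨ p q (x ∷ xs) with p x | q x | length-filterᵇ-∨ p q xs
  ... | true  | true  | ih = s≤s (≤-trans ih (+-monoʳ-≤ _ (n≤1+n _)))
  ... | true  | false | ih = s≤s ih
  ... | false | true  | ih = ≤-trans (s≤s ih) (≤-reflexive (sym (+-suc _ _)))
  ... | false | false | ih = ih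

  length-filterᵇ≤1 : ∀ (p : A → Bool) → (∀ {x y} → T (p x) → T (p y) → x ≡ y) →
                     ∀ {xs} → Unique xs → length (filterᵇ p xs) ≤ 1
  length-filterᵇ≤1 p p-unique {[]} _ = z≤n
  length-filterᵇ≤1 p p-unique {x ∷ xs} (x∉xs ∷ unique) with p x in px
  ... | true  = s≤s (≤-reflexive (cong length (filter-none (T? ∘ p) (All.map ¬p x∉xs))))
    where
    ¬p : ∀ {y} → x ≢ y → ¬ T (p y)
    ¬p x≢y py = x≢y (p-unique (Equivalence.from T-≡ px) py)
  ... | false = length-filterᵇ≤1 p p-unique unique

module _ (G : Graph) where

  Vertex : Set
  Vertex = Fin (n G)

  edge? : (u v : Vertex) → Dec (Edge G u v)
  edge? u v = adj G u v Bool.≟ true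

  edge-sym : ∀ {u v} → Edge G u v → Edge G v u
  edge-sym {u} {v} uv = trans (adj-sym G v u) uv

  edge-irrefl : ∀ {u} → ¬ Edge G u u
  edge-irrefl {u} uu with trans (sym (adj-irref G u)) uu
  ... | ()

  HasNeighbourIn : Subset (n G) → Vertex → Set
  HasNeighbourIn S v = ∃[ u ] u ∈ S × Edge G u v

  hasNeighbourIn? : ∀ S v → Dec (HasNeighbourIn S v)
  hasNeighbourIn? S v = any? (λ u → (u ∈? S) ×-dec edge? u v)

  independent-∪⁅⁆ : ∀ {S v} → Independent G S → ¬ HasNeighbourIn S v → Independent G (S ∪ ⁅ v ⁆)
  independent-∪⁅⁆ {S} {v} ind free u w u∈ w∈ uw with x∈p∪q⁻ S ⁅ v ⁆ u∈ | x∈p∪q⁻ S ⁅ v ⁆ w∈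
  ... | inj₁ u∈S | inj₁ w∈S = ind u w u∈S w∈S uw
  ... | inj₁ u∈S | inj₂ w∈v rewrite x∈⁅y⁆⇒x≡y v w∈v = free (u , u∈S , uw)
  ... | inj₂ u∈v | inj₁ w∈S rewrite x∈⁅y⁆⇒x≡y v u∈v = free (w , w∈S , edge-sym uw)
  ... | inj₂ u∈v | inj₂ w∈v rewrite x∈⁅y⁆⇒x≡y v u∈v | x∈⁅y⁆⇒x≡y v w∈v = edge-irrefl uw

  greedy : Subset (n G) → List Vertex → Subset (n G)
  greedy S [] = S
  greedy S (v ∷ vs) with hasNeighbourIn? S v
  ... | yes _ = greedy S vs
  ... | no _  = greedy (S ∪ ⁅ v ⁆) vs

  greedy-⊇ : ∀ S vs → S ⊆ greedy S vs
  greedy-⊇ S [] u∈S = u∈S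
  greedy-⊇ S (v ∷ vs) u∈S with hasNeighbourIn? S v
  ... | yes _ = greedy-⊇ S vs u∈S
  ... | no _  = greedy-⊇ (S ∪ ⁅ v ⁆) vs (p⊆p∪q ⁅ v ⁆ u∈S)

  greedy-independent : ∀ S vs → Independent G S → Independent G (greedy S vs)
  greedy-independent S [] ind = ind
  greedy-independent S (v ∷ vs) ind with hasNeighbourIn? S v
  ... | yes _    = greedy-independent S vs ind
  ... | no free  = greedy-independent (S ∪ ⁅ v ⁆) vs (independent-∪⁅⁆ ind free)

  greedy-dominating : ∀ S vs {v} → v List.∈ vs → v ∈ greedy S vs ⊎ HasNeighbourIn (greedy S vs) v
  greedy-dominating S (v ∷ vs) (here refl) with hasNeighbourIn? S v
  ... | yes (u , u∈S , uv) = inj₂ (u , greedy-⊇ S vs u∈S , uv)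
  ... | no _ = inj₁ (greedy-⊇ (S ∪ ⁅ v ⁆) vs (q⊆p∪q S ⁅ v ⁆ (x∈⁅x⁆ v)))
  greedy-dominating S (w ∷ vs) (there v∈vs) with hasNeighbourIn? S w
  ... | yes _ = greedy-dominating S vs v∈vs
  ... | no _  = greedy-dominating (S ∪ ⁅ w ⁆) vs v∈vs

  maximal-extension : ∀ S → Independent G S → ∃[ M ] MaximalIndependent G M × S ⊆ M
  maximal-extension S ind = M , (greedy-independent S vs ind , maximal) , greedy-⊇ S vs
    where
    vs : List Vertex
    vs = allFin (n G)
    M : Subset (n G)
    M = greedy S vs
    maximal : ∀ T → Independent G T → M ⊆ T → T ⊆ M
    maximal T indT M⊆T {v} v∈T with greedy-dominating S vs (∈-allFin v)
    ... | inj₁ v∈M = v∈M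
    ... | inj₂ (u , u∈M , uv) = contradiction uv (indT u v (M⊆T u∈M) v∈T)

  maximal-extension-∪⁅⁆ : ∀ {F x} → Independent G F → (∀ w → w ∈ F → ¬ Edge G x w) →
                          ∃[ M ] MaximalIndependent G M × F ∪ ⁅ x ⁆ ⊆ M
  maximal-extension-∪⁅⁆ {F} {x} ind x-free = maximal-extension (F ∪ ⁅ x ⁆)
    (independent-∪⁅⁆ ind λ (w , w∈F , wx) → x-free w w∈F (edge-sym wx))

  supported⇒free : ∀ {F u v} → Independent G F → Edge G u v → Supports G u v F → FreeIndependent G F
  supported⇒free {F} {u} {v} ind uv supp
    with maximal-extension-∪⁅⁆ ind (λ w w∈F → proj₁ (supp w w∈F))
       | maximal-extension-∪⁅⁆ ind (λ w w∈F → proj₂ (supp w w∈F))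
  ... | M₁ , M₁-max , F+u⊆M₁ | M₂ , M₂-max , F+v⊆M₂ =
    ind , M₁ , M₂ , M₁-max , M₂-max , F+u⊆M₁ ∘ p⊆p∪q ⁅ u ⁆ , F+v⊆M₂ ∘ p⊆p∪q ⁅ v ⁆ , M₁≢M₂
    where
    M₁≢M₂ : M₁ ≢ M₂
    M₁≢M₂ refl = proj₁ M₁-max u v (F+u⊆M₁ (q⊆p∪q F ⁅ u ⁆ (x∈⁅x⁆ u)))
                                  (F+v⊆M₂ (q⊆p∪q F ⁅ v ⁆ (x∈⁅x⁆ v))) uv

  incidences≤2 : ∀ {k} (e : Fin k → Vertex × Vertex) →
                 Injective _≡_ _≡_ (proj₁ ∘ e) → Injective _≡_ _≡_ (proj₂ ∘ e) →
                 ∀ x → incidences G e x ≤ 2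
  incidences≤2 {k} e fst-injective snd-injective x =
    ≤-trans (length-filterᵇ-∨ (endpoint proj₁) (endpoint proj₂) (allFin k))
            (+-mono-≤ (length-filterᵇ≤1 _ (unique proj₁ fst-injective) (allFin⁺ k))
                      (length-filterᵇ≤1 _ (unique proj₂ snd-injective) (allFin⁺ k)))
    where
    endpoint : (Vertex × Vertex → Vertex) → Fin k → Bool
    endpoint end j = ⌊ end (e j) ≟ᶠ x ⌋
    unique : ∀ end → Injective _≡_ _≡_ (end ∘ e) →
             ∀ {i j} → T (endpoint end i) → T (endpoint end j) → i ≡ j
    unique end inj ti tj = inj (trans (toWitness ti) (sym (toWitness tj)))

  ∈-Class⇒≡ : ∀ {t} {c : Vertex → Fin t} {i w} → w ∈ Class G c i → c w ≡ i
  ∈-Class⇒≡ {c = c} {i} {w} w∈ =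
    toWitness (Equivalence.from T-≡
      (trans (sym (lookup∘tabulate (λ v → ⌊ c v ≟ᶠ i ⌋) w)) ([]=⇒lookup w∈)))

-- Circular colourings

record CircColouring (G : Graph) (P D : ℕ) : Set where
  field
    colour     : Vertex G → ℕ
    colour<P   : ∀ v → colour v < P
    colour-adj : ∀ u v → Edge G u v → CircAdjℕ P D (colour u) (colour v)

module _ {G : Graph} where

  open CircColouring

  homToCirc⇒circColouring : ∀ {P D} → HomToCirc G P D → CircColouring G P D
  homToCirc⇒circColouring (f , hom) = record
    { colour = toℕ ∘ f ; colour<P = toℕ<n ∘ f ; colour-adj = λ u v → circAdj⇒circAdjℕ ∘ hom u v }

  properColouring⇒homToCirc : ∀ {k c} → ProperColouring G k c → HomToCirc G k 1
  properColouring⇒homToCirc {c = c} proper = c , λ u v uv →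
    circAdjℕ⇒circAdj {i = c u} {c v} (circAdj
      (n≢0⇒n>0 λ dist≡0 → proper u v uv (toℕ-injective (∣m-n∣≡0⇒m≡n dist≡0)))
      (pred-mono-≤ (m,n<o⇒∣m-n∣<o (toℕ<n (c u)) (toℕ<n (c v)))))

  circColouring⇒D+D≤P : ∀ {P D} → HasEdge G → CircColouring G P D → D + D ≤ P
  circColouring⇒D+D≤P (_ , _ , uv) c = circAdj⇒D+D≤P (colour-adj c _ _ uv)

  circColouring⇒colourable : ∀ {P} → CircColouring G P 1 → Colourable G P
  circColouring⇒colourable {P} c = (λ v → fromℕ< (colour<P c v)) , proper
    where
    proper : ProperColouring G P (λ v → fromℕ< (colour<P c v))
    proper u v uv same =
      circAdj-irrefl ≤-refl (subst (CircAdjℕ P 1 (colour c u)) (sym colour-u≡v) (colour-adj c u v uv))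
      where
      colour-u≡v : colour c u ≡ colour c v
      colour-u≡v = trans (sym (toℕ-fromℕ< (colour<P c u))) (trans (cong toℕ same) (toℕ-fromℕ< (colour<P c v)))

  circColouring-/ : ∀ {P D g} .{{_ : NonZero g}} → CircColouring G (P * g) (D * g) → CircColouring G P D
  circColouring-/ {g = g} c = record
    { colour = λ v → colour c v / g
    ; colour<P = λ v → m<n*o⇒m/o<n (colour<P c v)
    ; colour-adj = λ u v uv → circAdj-/ (colour-adj c u v uv)
    }

  module _ {P D : ℕ} .{{_ : NonZero P}} where

    Avoids : CircColouring G P D → ℕ → Set
    Avoids c z = ∀ v → colour c v ≢ z

    record TightAt (c : CircColouring G P D) (z : ℕ) : Set where
      constructor tightAt
      field
        left right   : Vertex G
        colour-left  : colour c left ≡ z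
        left-right   : Edge G left right
        colour-right : (colour c right + D) % P ≡ z

    tightAt? : ∀ c z → Dec (TightAt c z)
    tightAt? c z = map′ (λ (u , v , cu≡z , uv , cv+D≡z) → tightAt u v cu≡z uv cv+D≡z)
                        (λ (tightAt u v cu≡z uv cv+D≡z) → u , v , cu≡z , uv , cv+D≡z)
                        (any? λ u → any? λ v →
                          (colour c u ≟ z) ×-dec (edge? G u v ×-dec ((colour c v + D) % P ≟ z)))

    -- Only a neighbour of colour z − D could be adjacent to z but not to z − 1.
    push-away : 2 ≤ P → 1 ≤ D → ∀ {z} → z < P → (c : CircColouring G P D) → ¬ TightAt c z →
                Σ[ c' ∈ CircColouring G P D ] Avoids c' z
    push-away 2≤P 1≤D {z} z<P c ¬tight = c' , pushed≢z ∘ colour c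
      where
      pushed : ℕ → ℕ
      pushed x with x ≟ z
      ... | yes _ = (z + pred P) % P
      ... | no _  = x
      pushed<P : ∀ {x} → x < P → pushed x < P
      pushed<P {x} x<P with x ≟ z
      ... | yes _ = m%n<n _ P
      ... | no _  = x<P
      pushed≢z : ∀ x → pushed x ≢ z
      pushed≢z x with x ≟ z
      ... | yes _  = λ z⁻≡z → [m+o]%n≢m%n z (pred-mono-≤ 2≤P) (≤-reflexive (suc-pred P))
                               (trans z⁻≡z (sym (m<n⇒m%n≡m z<P)))
      ... | no x≢z = x≢z
      pushed-adj : ∀ u v → Edge G u v → CircAdjℕ P D (pushed (colour c u)) (pushed (colour c v))
      pushed-adj u v uv with colour c u ≟ z | colour c v ≟ z
      ... | yes cu≡z | yes cv≡z =
        contradiction (subst₂ (CircAdjℕ P D) cu≡z cv≡z (colour-adj c u v uv)) (circAdj-irrefl 1≤D)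
      ... | yes cu≡z | no _ = circAdj-push z<P (colour<P c v)
                                (subst (λ x → CircAdjℕ P D x (colour c v)) cu≡z (colour-adj c u v uv))
                                (¬tight ∘ tightAt u v cu≡z uv)
      ... | no _ | yes cv≡z = circAdj-sym (circAdj-push z<P (colour<P c u)
                                (subst (λ x → CircAdjℕ P D x (colour c u)) cv≡z (circAdj-sym (colour-adj c u v uv)))
                                (¬tight ∘ tightAt v u cv≡z (edge-sym G uv)))
      ... | no _ | no _ = colour-adj c u v uv
      c' : CircColouring G P D
      c' = record { colour = pushed ∘ colour c ; colour<P = pushed<P ∘ colour<P c ; colour-adj = pushed-adj }

    rotate-to-0 : ∀ {z} → z < P → (c : CircColouring G P D) → Avoids c z →
                  Σ[ c' ∈ CircColouring G P D ] Avoids c' 0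
    rotate-to-0 {z} z<P c avoids = c' , rotated≢0
      where
      rotate : ℕ → ℕ
      rotate x = (x + (P ∸ z)) % P
      c' : CircColouring G P D
      c' = record
        { colour     = rotate ∘ colour c
        ; colour<P   = λ v → m%n<n _ P
        ; colour-adj = λ u v uv → circAdj-rotate (P ∸ z) (colour<P c u) (colour<P c v) (colour-adj c u v uv)
        }
      rotate-z : rotate z ≡ 0
      rotate-z = trans (cong (_% P) (m+[n∸m]≡n (<⇒≤ z<P))) (n%n≡0 P)
      rotated≢0 : ∀ v → rotate (colour c v) ≢ 0
      rotated≢0 v rotated≡0 = avoids v (begin
        colour c v     ≡⟨ m<n⇒m%n≡m (colour<P c v) ⟨
        colour c v % P ≡⟨ [m+o]%n≡[k+o]%n⇒m%n≡k%n (colour c v) z (P ∸ z) (trans rotated≡0 (sym rotate-z)) ⟩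
        z % P          ≡⟨ m<n⇒m%n≡m z<P ⟩
        z              ∎)
        where open ≡-Reasoning

    farey-colouring : ∀ {D' Q} .{{_ : NonZero Q}} → P * D' ≡ Q * D + 1 →
                      (c : CircColouring G P D) → Avoids c 0 → CircColouring G Q D'
    farey-colouring {D'} {Q} bézout c avoids-0 = record
      { colour     = farey ∘ colour c
      ; colour<P   = λ v → farey<Q (colour<P c v)
      ; colour-adj = λ u v uv → farey-circAdj (P∤colour·Q u) (P∤colour·Q v) (colour-adj c u v uv)
      }
      where
      open Farey {Q = Q} bézout
      P∤colour·Q : ∀ v → ¬ P ∣ colour c v * Q
      P∤colour·Q v = P∤xQ (n≢0⇒n>0 (avoids-0 v)) (colour<P c v)

    ¬tightAt⇒fareyColouring : ∀ {D' Q z} .{{_ : NonZero Q}} → 2 ≤ P → 1 ≤ D → z < P →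
                              P * D' ≡ Q * D + 1 →
                              (c : CircColouring G P D) → ¬ TightAt c z → CircColouring G Q D'
    ¬tightAt⇒fareyColouring 2≤P 1≤D z<P bézout c ¬tight
      with push-away 2≤P 1≤D z<P c ¬tight
    ... | c₁ , avoids-z with rotate-to-0 z<P c₁ avoids-z
    ... | c₂ , avoids-0 = farey-colouring bézout c₂ avoids-0

-- Colourings in which every colour is tight

-- k (q + 1) + (k − 1)(q − 1) = (2k − 1) q + 1.
k*[1+q]≤P : ∀ k q .{{_ : NonZero q}} {P} .{{_ : NonZero P}} → 2 * k ≤ suc (pred P / q) → k * suc q ≤ P
k*[1+q]≤P zero q _ = z≤n
k*[1+q]≤P (suc k) q@(suc q₁) {P} 2k≤T = begin
  suc k * suc q                          ≤⟨ m≤m+n _ (k * q₁) ⟩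
  suc k * suc q + k * q₁                 ≡⟨ identity k q₁ ⟩
  suc (2 * k) * q + 1                    ≤⟨ +-monoˡ-≤ 1 (≤-trans (*-monoˡ-≤ q 2k+1≤) (m/n*n≤m (pred P) q)) ⟩
  pred P + 1                             ≡⟨ trans (+-comm (pred P) 1) (suc-pred P) ⟩
  P                                      ∎
  where
  open ≤-Reasoning
  identity : ∀ k q₁ → suc k * suc (suc q₁) + k * q₁ ≡ suc (2 * k) * suc q₁ + 1
  identity = solve-∀
  2k+1≤ : suc (2 * k) ≤ pred P / q
  2k+1≤ = s≤s⁻¹ (subst (_≤ suc (pred P / q)) (*-suc 2 k) 2k≤T)

-- Block j consists of the colours in [j q, (j + 1) q), q = D − 1; the tight edge at colour
-- (j + 1) q supports it, since both of its ends are less than D away from every colour of the block.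
module TightPartition {G : Graph} {P q : ℕ} .{{_ : NonZero P}} .{{_ : NonZero q}}
                      (c : CircColouring G P (suc q)) (tight : ∀ z → z < P → TightAt c z) where

  open CircColouring c

  t : ℕ
  t = suc (pred P / q)

  block : Vertex G → Fin t
  block v = fromℕ< (s≤s (/-monoˡ-≤ q (pred-mono-≤ (colour<P v))))

  ∈-block : ∀ {j w} → w ∈ Class G block j → colour w / q ≡ toℕ j
  ∈-block w∈ = trans (sym (toℕ-fromℕ< _)) (cong toℕ (∈-Class⇒≡ G w∈))

  block-independent : ∀ j → Independent G (Class G block j)
  block-independent j u w u∈ w∈ uw = <⇒≱ (<-trans close (n<1+n q)) (CircAdjℕ.D≤dist (colour-adj u w uw))
    where
    close : ∣ colour u - colour w ∣ < q
    close = m/o≡n/o⇒∣m-n∣<o (colour u) (colour w) q (trans (∈-block u∈) (sym (∈-block w∈)))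

  boundary : ℕ → ℕ
  boundary j = (suc j * q) % P

  tightEdge : (j : Fin t) → TightAt c (boundary (toℕ j))
  tightEdge j = tight _ (m%n<n _ P)

  open module TightEdge (j : Fin t) = TightAt (tightEdge j)

  block-supported : ∀ j → Supports G (left j) (right j) (Class G block j)
  block-supported j w w∈ = ¬left-w , ¬right-w
    where
    s : ℕ
    s = q ∸ colour w % q
    w+s≡boundary : (colour w + s) % P ≡ boundary (toℕ j)
    w+s≡boundary = cong (_% P) (trans (m+[n∸m%n]≡[1+m/n]*n (colour w) q)
                                      (cong (λ J → suc J * q) (∈-block w∈)))
    0<s : 0 < s
    0<s = m<n⇒0<n∸m (m%n<n (colour w) q)
    s<D : s < suc q
    s<D = s≤s (m∸n≤m q (colour w % q))
    ¬left-w : ¬ Edge G (left j) w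
    ¬left-w lw = ¬circAdj-close (colour<P (left j)) (colour<P w) s<D
                   (trans w+s≡boundary (sym (colour-left j))) (colour-adj _ _ lw)
    right+[D∸s]≡w : (colour (right j) + (suc q ∸ s)) % P ≡ colour w
    right+[D∸s]≡w = trans ([m+o]%n≡[k+o]%n⇒m%n≡k%n _ (colour w) s (begin
      (colour (right j) + (suc q ∸ s) + s) % P ≡⟨ cong (_% P) (+-assoc (colour (right j)) _ s) ⟩
      (colour (right j) + (suc q ∸ s + s)) % P ≡⟨ cong (λ d → (colour (right j) + d) % P) (m∸n+n≡m (<⇒≤ s<D)) ⟩
      (colour (right j) + suc q) % P           ≡⟨ colour-right j ⟩
      boundary (toℕ j)                         ≡⟨ w+s≡boundary ⟨
      (colour w + s) % P                       ∎)) (m<n⇒m%n≡m (colour<P w))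
      where open ≡-Reasoning
    ¬right-w : ¬ Edge G (right j) w
    ¬right-w rw = ¬circAdj-close (colour<P w) (colour<P (right j))
                    (∸-monoʳ-< 0<s (<⇒≤ s<D))
                    right+[D∸s]≡w (circAdj-sym (colour-adj _ _ rw))

  boundary-≢ : ∀ {i j} → i < j → j < t → boundary i ≢ boundary j
  boundary-≢ {i} {j} i<j j<t boundary-i≡j with m≤n⇒∃[o]m+o≡n i<j
  ... | d , refl = [m+o]%n≢m%n (suc i * q) (≤-trans (>-nonZero⁻¹ q) (m≤m+n q (d * q))) dq<P
                     (trans (cong (_% P) (regroup i d q)) (sym boundary-i≡j))
    where
    regroup : ∀ i d q → suc i * q + suc d * q ≡ suc (suc i + d) * q
    regroup = solve-∀
    dq<P : suc d * q < P
    dq<P = begin-strict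
      suc d * q         ≤⟨ *-monoˡ-≤ q (s≤s (m≤n+m d i)) ⟩
      (suc i + d) * q   ≤⟨ *-monoˡ-≤ q (s≤s⁻¹ j<t) ⟩
      pred P / q * q    ≤⟨ m/n*n≤m (pred P) q ⟩
      pred P            <⟨ ≤-reflexive (suc-pred P) ⟩
      P                 ∎
      where open ≤-Reasoning

  boundary-injective : ∀ {i j : Fin t} → boundary (toℕ i) ≡ boundary (toℕ j) → i ≡ j
  boundary-injective {i} {j} eq with <-cmp (toℕ i) (toℕ j)
  ... | tri< i<j _ _ = contradiction eq (boundary-≢ i<j (toℕ<n j))
  ... | tri≈ _ i≡j _ = toℕ-injective i≡j
  ... | tri> _ _ j<i = contradiction (sym eq) (boundary-≢ j<i (toℕ<n i))

  phiFeasible : ∀ a b → 2 ≤ b → PhiFeasible G a b t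
  phiFeasible a b 2≤b =
    block , block-independent , edge ,
    (λ j → supported⇒free G (block-independent (ι j)) (left-right (ι j)) (block-supported (ι j))) ,
    (λ j → left-right (ι j)) , (λ j → block-supported (ι j)) ,
    (λ x → ≤-trans (incidences≤2 G edge left-injective right-injective x) 2≤b)
    where
    ι : Fin (t ∸ a) → Fin t
    ι j = inject≤ j (m∸n≤m t a)
    edge : Fin (t ∸ a) → Vertex G × Vertex G
    edge j = left (ι j) , right (ι j)
    left-injective : Injective _≡_ _≡_ (left ∘ ι)
    left-injective {i} {j} eq = inject≤-injective _ _ i j (boundary-injective
      (trans (sym (colour-left (ι i))) (trans (cong colour eq) (colour-left (ι j)))))
    right-injective : Injective _≡_ _≡_ (right ∘ ι)
    right-injective {i} {j} eq = inject≤-injective _ _ i j (boundary-injective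
      (trans (sym (colour-right (ι i)))
             (trans (cong (λ v → (colour v + suc q) % P) eq) (colour-right (ι j)))))

-- Induction on P

module _ {G : Graph} (has-edge : HasEdge G) {k : ℕ} (χ≡k : IsChromaticNumber G k)
         {a b : ℕ} (2≤b : 2 ≤ b) (φ≥2k : PhiAtLeast G a b (2 * k)) where

  Bound : ℕ → Set
  Bound P = ∀ {D} → CircColouring G P D → k * D ≤ P

  BoundBelow : ℕ → Set
  BoundBelow P = ∀ {P'} → P' < P → Bound P'

  bound-by-common-factor : .{{_ : NonZero P}} → BoundBelow P → ¬ Coprime P D →
                           CircColouring G P D → k * D ≤ P
  bound-by-common-factor below ¬coprime c with ¬coprime⇒common-factor ¬coprime
  ... | g , P₁ , D₁ , 1<g , P₁<P , refl , refl =
    subst (_≤ P₁ * g) (*-assoc k D₁ g) (*-monoˡ-≤ g (below P₁<P (circColouring-/ c)))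
    where
    instance
      g≢0 : NonZero g
      g≢0 = >-nonZero (<-trans z<s 1<g)

  bound-by-partition : ∀ q .{{_ : NonZero q}} .{{_ : NonZero P}} (c : CircColouring G P (suc q)) →
                       (∀ z → z < P → TightAt c z) → k * suc q ≤ P
  bound-by-partition q c tight = k*[1+q]≤P k q (φ≥2k _ (TightPartition.phiFeasible c tight a b 2≤b))

  bound-by-farey : ∀ {z} .{{_ : NonZero P}} → BoundBelow P → 2 ≤ P → 2 ≤ D → Coprime P D → z < P →
                   (c : CircColouring G P D) → ¬ TightAt c z → k * D ≤ P
  bound-by-farey {P} below 2≤P 2≤D coprime z<P c ¬tight with farey-neighbour coprime 2≤D
  ... | D' , Q , D'<D , bézout =
    farey-neighbour-bound {Q = Q} bézout {k} (below (farey-neighbour-< {Q = Q} bézout D'<D)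
      (¬tightAt⇒fareyColouring 2≤P (<-trans z<s 2≤D) z<P bézout c ¬tight))
    where
    instance
      Q≢0 : NonZero Q
      Q≢0 = ≢-nonZero λ { refl → <⇒≢ 2≤P (sym (m*n≡1⇒m≡1 P D' bézout)) }

  bound≥2 : ∀ q .{{_ : NonZero q}} .{{_ : NonZero P}} → BoundBelow P → 2 ≤ P →
            (c : CircColouring G P (suc q)) → k * suc q ≤ P
  bound≥2 {P} q below 2≤P c with coprime? P (suc q) | anyUpTo? (λ z → ¬? (tightAt? c z)) P
  ... | no ¬coprime | _ = bound-by-common-factor below ¬coprime c
  ... | yes coprime | yes (z , z<P , ¬tight) =
    bound-by-farey below 2≤P (s≤s (>-nonZero⁻¹ q)) coprime z<P c ¬tight
  ... | yes _ | no none-loose =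
    bound-by-partition q c λ z z<P →
      decidable-stable (tightAt? c z) λ ¬tight → none-loose (z , z<P , ¬tight)

  circColouring⇒k*D≤P : ∀ P → Bound P
  circColouring⇒k*D≤P = <-rec Bound step
    where
    step : ∀ P → BoundBelow P → Bound P
    step P below {zero} c = subst (_≤ P) (sym (*-zeroʳ k)) z≤n
    step P below {suc zero} c = subst (_≤ P) (sym (*-identityʳ k)) (proj₂ χ≡k P (circColouring⇒colourable c))
    step P below {suc (suc q)} c = bound≥2 (suc q) below 2≤P c
      where
      2≤P : 2 ≤ P
      2≤P = ≤-trans (s≤s (s≤s z≤n)) (circColouring⇒D+D≤P has-edge c)
      instance
        P≢0 : NonZero P
        P≢0 = >-nonZero (<-trans z<s 2≤P)

mainTheorem7 : (G : Graph) → HasEdge G → (k : ℕ) → IsChromaticNumber G k →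
    (a b : ℕ) → 2 ≤ b → PhiAtLeast G a b (2 * k) → IsCircChromatic G k 1
mainTheorem7 G has-edge k χ≡k a b 2≤b φ≥2k =
  (≤-refl , 2≤k , Coprimality.sym (1-coprimeTo k) , k-colouring) , minimal
  where
  k-colouring : HomToCirc G k 1
  k-colouring = properColouring⇒homToCirc {G = G} (proj₂ (proj₁ χ≡k))
  2≤k : 2 ≤ k
  2≤k = circColouring⇒D+D≤P has-edge (homToCirc⇒circColouring {G = G} k-colouring)
  minimal : ∀ p d → CircAdmissible G p d → k * d ≤ p * 1
  minimal p d (_ , _ , _ , hom) = subst (k * d ≤_) (sym (*-identityʳ p))
    (circColouring⇒k*D≤P {G = G} has-edge χ≡k {a} {b} 2≤b φ≥2k p (homToCirc⇒circColouring {G = G} hom))
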